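{- There exists an absolute constant $k'$ such that for all natural numbers $k \geq k'$, $$4 p_2 p_3 \cdots p_k < \min\left\{ 2 p_{k+1} \cdots p_{u_{4/3}(k)},\ p_{k+1} \cdots p_{u_2(k)} \right\}.$$
   Context: $p_i$ denotes the $i$-th prime ($p_1 = 2, p_2 = 3, \ldots$). For $\lambda > 1$ and natural $k$, $u_\lambda(k) = \min\{ s : \prod_{j=k+1}^{s} \frac{p_j}{p_j - 1} \geq \lambda \}$. -}

module Defs where

open import Data.Nat using (ℕ; zero; suc; _+_; _*_; _∸_; _≤_; _!)

open import Data.Nat.Primality using (prime?)
open import Data.List using (List; map; applyUpTo)
open import Data.Nat.ListAction using (product)
open import Data.Product using (_×_)
open import Relation.Nullary using (yes; no)

-- Search for the first prime among m, m+1, ..., m+fuel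
-- (returns m+fuel unchecked if none found earlier; never happens below).
findPrime : (fuel m : ℕ) → ℕ
findPrime zero m = m
findPrime (suc fuel) m with prime? m
... | yes _ = m
... | no  _ = findPrime fuel (suc m)

-- Least prime > n: by Euclid there is a prime in (n, n! + n + 1].
nextPrime : ℕ → ℕ
nextPrime n = findPrime (n !) (suc n)

-- p i = i-th prime, 1-indexed: p 1 = 2, p 2 = 3, ...  (p 0 is an unused dummy value)
p : ℕ → ℕ
p zero = 1
p (suc zero) = 2
p (suc (suc i)) = nextPrime (p (suc i))

-- the list a, a+1, ..., b  (empty if b < a)
range : ℕ → ℕ → List ℕ
range a b = applyUpTo (a +_) (suc b ∸ a)

∏[_,_] : ℕ → ℕ → (ℕ → ℕ) → ℕ
∏[ a , b ] f = product (map f (range a b))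

-- ∏_{j=k+1}^{s} p_j/(p_j - 1) ≥ num/den, with positive denominators cleared:
-- den * ∏ p_j ≥ num * ∏ (p_j - 1)
Reaches : (num den k s : ℕ) → Set
Reaches num den k s = num * ∏[ suc k , s ] (λ j → p j ∸ 1) ≤ den * ∏[ suc k , s ] p

-- IsU num den k s :  s = u_{num/den}(k), i.e. s is the least index with Reaches.
IsU : (num den k s : ℕ) → Set
IsU num den k s = Reaches num den k s × (∀ t → Reaches num den k t → s ≤ t)

-- Let q = p k.  At most 8 of any 30 consecutive integers are prime to 30 and 8/30 < 1/3, so
-- q ≥ 3(k + 1) once k ≥ 66.  The i-th prime after q is at least q + i, so over the n primes
-- after q the product of p/(p − 1) is at most ∏ (q + i)/(q + i − 1) = (q + n)/q.  Reaching
-- (a + 1)/a, with a = 3 or a = 1, thus forces q ≤ a n, hence n ≥ k + 1; the product of those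
-- n primes is then at least q^(k+1) ≥ 9 q^(k−1) > 4 p 2 ⋯ p k.
module Submission where

open import Defs
open import Data.Nat
  using (ℕ; zero; suc; _+_; _*_; _∸_; _^_; _≤_; _<_; _≥_; _⊓_; _!; _%_; _/_; _≤′_; ≤′-refl; ≤′-step; z≤n; s≤s; z<s;
         NonZero; >-nonZero; nonTrivial⇒≢1; n>1⇒nonTrivial)
open import Data.Nat.Properties
open import Data.Nat.Divisibility using (_∣_; hasNonTrivialDivisor; ∣⇒≤; ∣1⇒≡1; ∣m+n∣m⇒∣n; m≤n⇒m!∣n!; m∣m*n; ∣-trans; m%n≡0⇒n∣m)
open import Data.Nat.DivMod using (m≡m%n+[m/n]*n; [m+kn]%n≡m%n; m%n<n)
open import Data.Nat.Primality using (Prime; prime?; prime[2]; prime⇒nonZero; prime⇒nonTrivial)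
open import Data.Nat.Primality.Factorisation using (factorise)
open import Data.Nat.ListAction using (product)
open import Data.Nat.Tactic.RingSolver using (solve-∀)
import Algebra.Properties.CommutativeSemigroup as CommutativeSemigroupProperties
open import Data.List using ([]; _∷_; applyUpTo)
open import Data.List.Properties using (map-applyUpTo)
open import Data.List.Relation.Unary.All using (_∷_)
open import Data.Product using (∃; _×_; _,_)
open import Data.Sum using (inj₁; inj₂)
open import Data.Unit using (tt)
open import Function using (_∘_)
open import Relation.Nullary using (yes; no; contradiction)
open import Relation.Binary.PropositionalEquality using (_≡_; refl; sym; trans; cong; cong₂; subst; subst₂; module ≡-Reasoning)

module +-Comm = CommutativeSemigroupProperties +-commutativeSemigroup
module *-Comm = CommutativeSemigroupProperties *-commutativeSemigroup

module _ {f : ℕ → ℕ} where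

  stepwise⇒mono-≤ : (∀ n → f n ≤ f (suc n)) → ∀ {m n} → m ≤ n → f m ≤ f n
  stepwise⇒mono-≤ f-step m≤n = go (≤⇒≤′ m≤n)
    where
    go : ∀ {m n} → m ≤′ n → f m ≤ f n
    go ≤′-refl = ≤-refl
    go (≤′-step m≤′n) = ≤-trans (go m≤′n) (f-step _)

  stepwise⇒mono-< : (∀ n → f n < f (suc n)) → ∀ {m n} → m < n → f m < f n
  stepwise⇒mono-< f-step {m} m<n = <-≤-trans (f-step m) (stepwise⇒mono-≤ (<⇒≤ ∘ f-step) m<n)

n∣n! : ∀ n .{{_ : NonZero n}} → n ∣ n !
n∣n! (suc n) = m∣m*n (n !)

prime-divisor : ∀ {n} → 1 < n → ∃ λ r → Prime r × r ∣ n
prime-divisor {n} 1<n with factorise n {{>-nonZero (<-trans z<s 1<n)}}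
... | record { factors = [] ; isFactorisation = n≡1 } = contradiction n≡1 (>⇒≢ 1<n)
... | record { factors = r ∷ rs ; isFactorisation = n≡r*rs ; factorsPrime = r-prime ∷ _ } =
  r , r-prime , subst (r ∣_) (sym n≡r*rs) (m∣m*n (product rs))

prime∣n!+1⇒n<prime : ∀ {n r} → Prime r → r ∣ n ! + 1 → n < r
prime∣n!+1⇒n<prime {n} {r} r-prime r∣n!+1 = ≰⇒> λ r≤n →
  nonTrivial⇒≢1 {{prime⇒nonTrivial r-prime}}
    (∣1⇒≡1 (∣m+n∣m⇒∣n r∣n!+1 (∣-trans (n∣n! r {{prime⇒nonZero r-prime}}) (m≤n⇒m!∣n! r≤n))))

euclid : ∀ n → ∃ λ r → Prime r × n < r × r ≤ n ! + 1
euclid n with prime-divisor {n ! + 1} (+-monoˡ-≤ 1 (1≤n! n))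
... | r , r-prime , r∣n!+1 =
  r , r-prime , prime∣n!+1⇒n<prime r-prime r∣n!+1 , ∣⇒≤ {{>-nonZero (m≤n+m 1 (n !))}} r∣n!+1

findPrime-≥ : ∀ fuel m → m ≤ findPrime fuel m
findPrime-≥ zero m = ≤-refl
findPrime-≥ (suc fuel) m with prime? m
... | yes _ = ≤-refl
... | no _ = ≤-trans (n≤1+n m) (findPrime-≥ fuel (suc m))

findPrime-prime : ∀ fuel {m r} → Prime r → m ≤ r → r ≤ m + fuel → Prime (findPrime fuel m)
findPrime-prime zero {m} {r} r-prime m≤r r≤m+0 =
  subst Prime (≤-antisym (subst (r ≤_) (+-identityʳ m) r≤m+0) m≤r) r-prime
findPrime-prime (suc fuel) {m} {r} r-prime m≤r r≤m+1+fuel with prime? m | m≤n⇒m<n∨m≡n m≤r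
... | yes m-prime | _ = m-prime
... | no m-composite | inj₂ refl = contradiction r-prime m-composite
... | no _ | inj₁ m<r = findPrime-prime fuel r-prime m<r (subst (r ≤_) (+-suc m fuel) r≤m+1+fuel)

nextPrime-prime : ∀ n → Prime (nextPrime n)
nextPrime-prime n with euclid n
... | r , r-prime , n<r , r≤n!+1 = findPrime-prime (n !) r-prime n<r
  (≤-trans r≤n!+1 (subst (n ! + 1 ≤_) (+-comm (n !) (suc n)) (+-monoʳ-≤ (n !) (s≤s z≤n))))

n<nextPrime : ∀ n → n < nextPrime n
n<nextPrime n = findPrime-≥ (n !) (suc n)

p-prime : ∀ i → Prime (p (suc i))
p-prime zero = prime[2]
p-prime (suc i) = nextPrime-prime (p (suc i))

p[i]<p[1+i] : ∀ i → p i < p (suc i)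
p[i]<p[1+i] zero = s≤s (s≤s z≤n)
p[i]<p[1+i] (suc i) = n<nextPrime (p (suc i))

p-mono-< : ∀ {i j} → i < j → p i < p j
p-mono-< = stepwise⇒mono-< p[i]<p[1+i]

p-mono-≤ : ∀ {i j} → i ≤ j → p i ≤ p j
p-mono-≤ = stepwise⇒mono-≤ (<⇒≤ ∘ p[i]<p[1+i])

i<p[i] : ∀ i → i < p i
i<p[i] zero = s≤s z≤n
i<p[i] (suc i) = ≤-<-trans (i<p[i] i) (p[i]<p[1+i] i)

sgn : ℕ → ℕ
sgn zero = 0
sgn (suc _) = 1

coprime30 : ℕ → ℕ
coprime30 n = sgn (n % 2) * sgn (n % 3) * sgn (n % 5)

countCoprime30 : ℕ → ℕ
countCoprime30 zero = 0
countCoprime30 (suc n) = countCoprime30 n + coprime30 n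

coprime30-+30 : ∀ n → coprime30 (n + 30) ≡ coprime30 n
coprime30-+30 n = cong₂ _*_
  (cong₂ _*_ (cong sgn ([m+kn]%n≡m%n n 15 2)) (cong sgn ([m+kn]%n≡m%n n 10 3)))
  (cong sgn ([m+kn]%n≡m%n n 6 5))

sgn[prime%d]≡1 : ∀ {r} d .{{_ : NonZero d}} → 1 < d → d < r → Prime r → sgn (r % d) ≡ 1
sgn[prime%d]≡1 {r} d 1<d d<r r-prime with r % d in r%d≡0
... | suc _ = refl
... | zero = contradiction (hasNonTrivialDivisor {{n>1⇒nonTrivial 1<d}} d<r (m%n≡0⇒n∣m r d r%d≡0)) (Prime.notComposite r-prime)

coprime30-prime : ∀ {r} → 5 < r → Prime r → coprime30 r ≡ 1
coprime30-prime {r} 5<r r-prime =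
  cong₂ _*_ (cong₂ _*_ (sgn≡1 2 ≤-refl 2≤5) (sgn≡1 3 (≤ᵇ⇒≤ 2 3 tt) 3≤5)) (sgn≡1 5 2≤5 ≤-refl)
  where
  2≤5 : 2 ≤ 5
  2≤5 = ≤ᵇ⇒≤ 2 5 tt
  3≤5 : 3 ≤ 5
  3≤5 = ≤ᵇ⇒≤ 3 5 tt
  sgn≡1 : ∀ d .{{_ : NonZero d}} → 1 < d → d ≤ 5 → sgn (r % d) ≡ 1
  sgn≡1 d 1<d d≤5 = sgn[prime%d]≡1 d 1<d (≤-<-trans d≤5 5<r) r-prime

countCoprime30-mono-≤ : ∀ {m n} → m ≤ n → countCoprime30 m ≤ countCoprime30 n
countCoprime30-mono-≤ = stepwise⇒mono-≤ (λ n → m≤m+n (countCoprime30 n) (coprime30 n))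

countCoprime30-+30 : ∀ n → countCoprime30 (n + 30) ≡ countCoprime30 n + 8
countCoprime30-+30 zero = refl
countCoprime30-+30 (suc n) = trans
  (cong₂ _+_ (countCoprime30-+30 n) (coprime30-+30 n))
  (+-Comm.xy∙z≈xz∙y (countCoprime30 n) 8 (coprime30 n))

countCoprime30-+*30 : ∀ x a → countCoprime30 (x + a * 30) ≡ countCoprime30 x + a * 8
countCoprime30-+*30 x zero = trans (cong countCoprime30 (+-identityʳ x)) (sym (+-identityʳ (countCoprime30 x)))
countCoprime30-+*30 x (suc a) = begin
  countCoprime30 (x + (30 + a * 30)) ≡⟨ cong countCoprime30 (+-Comm.x∙yz≈xz∙y x 30 (a * 30)) ⟩
  countCoprime30 (x + a * 30 + 30)   ≡⟨ countCoprime30-+30 (x + a * 30) ⟩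
  countCoprime30 (x + a * 30) + 8    ≡⟨ cong (_+ 8) (countCoprime30-+*30 x a) ⟩
  countCoprime30 x + a * 8 + 8       ≡⟨ +-Comm.x∙yz≈xz∙y (countCoprime30 x) 8 (a * 8) ⟨
  countCoprime30 x + (8 + a * 8)     ∎
  where open ≡-Reasoning

countCoprime30-bound : ∀ n → 30 * countCoprime30 n ≤ 8 * n + 240
countCoprime30-bound n = subst (λ m → 30 * countCoprime30 m ≤ 8 * m + 240) (sym (m≡m%n+[m/n]*n n 30)) (begin
  30 * countCoprime30 (x + a * 30)   ≡⟨ cong (30 *_) (countCoprime30-+*30 x a) ⟩
  30 * (countCoprime30 x + a * 8)    ≡⟨ distrib (countCoprime30 x) a ⟩
  30 * countCoprime30 x + 8 * (a * 30)
    ≤⟨ +-monoˡ-≤ (8 * (a * 30)) (*-monoʳ-≤ 30 (countCoprime30-mono-≤ (<⇒≤ (m%n<n n 30)))) ⟩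
  240 + 8 * (a * 30)                 ≤⟨ m≤n+m (240 + 8 * (a * 30)) (8 * x) ⟩
  8 * x + (240 + 8 * (a * 30))       ≡⟨ collect x a ⟩
  8 * (x + a * 30) + 240             ∎)
  where
  open ≤-Reasoning
  x a : ℕ
  x = n % 30
  a = n / 30
  distrib : ∀ c a → 30 * (c + a * 8) ≡ 30 * c + 8 * (a * 30)
  distrib = solve-∀
  collect : ∀ x a → 8 * x + (240 + 8 * (a * 30)) ≡ 8 * (x + a * 30) + 240
  collect = solve-∀

d≤countCoprime30[1+p[4+d]] : ∀ d → d ≤ countCoprime30 (suc (p (4 + d)))
d≤countCoprime30[1+p[4+d]] zero = z≤n
d≤countCoprime30[1+p[4+d]] (suc d) = begin
  suc d                                          ≤⟨ s≤s (d≤countCoprime30[1+p[4+d]] d) ⟩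
  suc (countCoprime30 (suc (p (4 + d))))         ≤⟨ s≤s (countCoprime30-mono-≤ (p[i]<p[1+i] (4 + d))) ⟩
  suc (countCoprime30 q)                         ≡⟨ +-comm 1 (countCoprime30 q) ⟩
  countCoprime30 q + 1                           ≡⟨ cong (countCoprime30 q +_) (coprime30-prime 5<q (p-prime (4 + d))) ⟨
  countCoprime30 (suc q)                         ∎
  where
  open ≤-Reasoning
  q : ℕ
  q = p (5 + d)
  5<q : 5 < q
  5<q = ≤-<-trans (m≤m+n 5 d) (i<p[i] (5 + d))

3*[1+k]≤p[k] : ∀ {k} → 66 ≤ k → 3 * suc k ≤ p k
3*[1+k]≤p[k] {k} 66≤k = *-cancelˡ-≤ 8 (+-cancelʳ-≤ (6 * k) (8 * (3 * suc k)) (8 * q) (begin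
  8 * (3 * suc k) + 6 * k ≡⟨ expand k ⟩
  30 * k + 24             ≤⟨ +-monoˡ-≤ 24 30k≤8q+368 ⟩
  8 * q + 368 + 24        ≡⟨ +-assoc (8 * q) 368 24 ⟩
  8 * q + 392             ≤⟨ +-monoʳ-≤ (8 * q) (≤-trans (≤ᵇ⇒≤ 392 396 tt) (*-monoʳ-≤ 6 66≤k)) ⟩
  8 * q + 6 * k           ∎))
  where
  open ≤-Reasoning
  q d : ℕ
  q = p k
  d = k ∸ 4
  k≡4+d : k ≡ 4 + d
  k≡4+d = sym (m+[n∸m]≡n (≤-trans (≤ᵇ⇒≤ 4 66 tt) 66≤k))
  expand : ∀ k → 8 * (3 * suc k) + 6 * k ≡ 30 * k + 24
  expand = solve-∀
  30k≤8q+368 : 30 * k ≤ 8 * q + 368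
  30k≤8q+368 = begin
    30 * k                         ≡⟨ cong (30 *_) k≡4+d ⟩
    30 * (4 + d)                   ≡⟨ *-distribˡ-+ 30 4 d ⟩
    120 + 30 * d                   ≤⟨ +-monoʳ-≤ 120 (*-monoʳ-≤ 30 d≤count) ⟩
    120 + 30 * countCoprime30 (suc q) ≤⟨ +-monoʳ-≤ 120 (countCoprime30-bound (suc q)) ⟩
    120 + (8 * suc q + 240)        ≡⟨ collect q ⟩
    8 * q + 368                    ∎
    where
    d≤count : d ≤ countCoprime30 (suc q)
    d≤count = subst (λ i → d ≤ countCoprime30 (suc (p i))) (sym k≡4+d) (d≤countCoprime30[1+p[4+d]] d)
    collect : ∀ q → 120 + (8 * suc q + 240) ≡ 8 * q + 368
    collect = solve-∀

product-applyUpTo-≤-^ : ∀ {q} g n → (∀ {i} → i < n → g i ≤ q) → product (applyUpTo g n) ≤ q ^ n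
product-applyUpTo-≤-^ g zero _ = ≤-refl
product-applyUpTo-≤-^ g (suc n) g≤q = *-mono-≤ (g≤q z<s) (product-applyUpTo-≤-^ (g ∘ suc) n (g≤q ∘ s≤s))

^-≤-product-applyUpTo : ∀ {q} g n → (∀ i → q ≤ g i) → q ^ n ≤ product (applyUpTo g n)
^-≤-product-applyUpTo g zero _ = ≤-refl
^-≤-product-applyUpTo g (suc n) q≤g = *-mono-≤ (q≤g 0) (^-≤-product-applyUpTo (g ∘ suc) n (q≤g ∘ suc))

product-ratio-telescopes : ∀ {q} g n → q < g 0 → (∀ i → g i < g (suc i)) →
  q * product (applyUpTo g n) ≤ (q + n) * product (applyUpTo (λ i → g i ∸ 1) n)
product-ratio-telescopes {q} g zero _ _ = ≤-reflexive (cong (_* 1) (sym (+-identityʳ q)))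
product-ratio-telescopes {q} g (suc n) q<g₀ g-step = begin
  q * (g 0 * G)                  ≤⟨ *-monoʳ-≤ q (product-ratio-telescopes (g ∘ suc) n (g-step 0) (g-step ∘ suc)) ⟩
  q * ((g 0 + n) * G′)           ≡⟨ *-assoc q (g 0 + n) G′ ⟨
  q * (g 0 + n) * G′             ≤⟨ *-monoˡ-≤ G′ (step q<g₀) ⟩
  (q + suc n) * (g 0 ∸ 1) * G′   ≡⟨ *-assoc (q + suc n) (g 0 ∸ 1) G′ ⟩
  (q + suc n) * ((g 0 ∸ 1) * G′) ∎
  where
  open ≤-Reasoning
  G G′ : ℕ
  G = product (applyUpTo (g ∘ suc) n)
  G′ = product (applyUpTo (λ i → g (suc i) ∸ 1) n)
  step : ∀ {x} → q < x → q * (x + n) ≤ (q + suc n) * (x ∸ 1)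
  step {suc y} (s≤s q≤y) = begin
    q * (1 + y + n)     ≡⟨ rearrange q y n ⟩
    q * y + (1 + n) * q ≤⟨ +-monoʳ-≤ (q * y) (*-monoʳ-≤ (1 + n) q≤y) ⟩
    q * y + (1 + n) * y ≡⟨ *-distribʳ-+ y q (1 + n) ⟨
    (q + suc n) * y     ∎
    where
    rearrange : ∀ q y n → q * (1 + y + n) ≡ q * y + (1 + n) * q
    rearrange = solve-∀

ratio≥[1+a]/a⇒q≤a*n : ∀ {q} a g n → 0 < q → q < g 0 → (∀ i → g i < g (suc i)) →
  suc a * product (applyUpTo (λ i → g i ∸ 1) n) ≤ a * product (applyUpTo g n) → q ≤ a * n
ratio≥[1+a]/a⇒q≤a*n {q} a g n 0<q q<g₀ g-step ratio≥ = +-cancelʳ-≤ (a * q) q (a * n) (begin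
  q + a * q     ≤⟨ *-cancelʳ-≤ (suc a * q) (a * (q + n)) P′ {{P′≢0}} cleared ⟩
  a * (q + n)   ≡⟨ *-distribˡ-+ a q n ⟩
  a * q + a * n ≡⟨ +-comm (a * q) (a * n) ⟩
  a * n + a * q ∎)
  where
  open ≤-Reasoning
  P P′ : ℕ
  P = product (applyUpTo g n)
  P′ = product (applyUpTo (λ i → g i ∸ 1) n)
  1≤g∸1 : ∀ i → 1 ≤ g i ∸ 1
  1≤g∸1 i = ∸-monoˡ-≤ 1 (≤-trans (s≤s 0<q) (≤-trans q<g₀ (stepwise⇒mono-≤ (<⇒≤ ∘ g-step) z≤n)))
  P′≢0 : NonZero P′
  P′≢0 = >-nonZero (subst (_≤ P′) (^-zeroˡ n) (^-≤-product-applyUpTo (λ i → g i ∸ 1) n 1≤g∸1))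
  cleared : suc a * q * P′ ≤ a * (q + n) * P′
  cleared = begin
    suc a * q * P′     ≡⟨ *-Comm.xy∙z≈xz∙y (suc a) q P′ ⟩
    suc a * P′ * q     ≤⟨ *-monoˡ-≤ q ratio≥ ⟩
    a * P * q          ≡⟨ *-Comm.xy∙z≈x∙zy a P q ⟩
    a * (q * P)        ≤⟨ *-monoʳ-≤ a (product-ratio-telescopes g n q<g₀ g-step) ⟩
    a * ((q + n) * P′) ≡⟨ *-assoc a (q + n) P′ ⟨
    a * (q + n) * P′   ∎

∏-as-applyUpTo : ∀ a b f → ∏[ a , b ] f ≡ product (applyUpTo (λ i → f (a + i)) (suc b ∸ a))
∏-as-applyUpTo a b f = cong product (map-applyUpTo (a +_) f (suc b ∸ a))

reaches⇒p≤a*length : ∀ a k s → Reaches (suc a) a k s → p k ≤ a * (s ∸ k)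
reaches⇒p≤a*length a k s reaches = ratio≥[1+a]/a⇒q≤a*n a (λ i → p (suc k + i)) (s ∸ k)
  (≤-<-trans z≤n (i<p[i] k))
  (p-mono-< (s≤s (m≤m+n k 0)))
  (λ i → p-mono-< (+-monoʳ-< (suc k) (n<1+n i)))
  (subst₂ _≤_ (cong (suc a *_) (∏-as-applyUpTo (suc k) s (λ j → p j ∸ 1)))
              (cong (a *_) (∏-as-applyUpTo (suc k) s p)) reaches)

∏[2,1+k]p≤p[1+k]^k : ∀ k → ∏[ 2 , suc k ] p ≤ p (suc k) ^ k
∏[2,1+k]p≤p[1+k]^k k = subst (_≤ p (suc k) ^ k) (sym (∏-as-applyUpTo 2 (suc k) p))
  (product-applyUpTo-≤-^ (λ i → p (2 + i)) k (λ i<k → p-mono-≤ (s≤s i<k)))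

p[k]^length≤∏[1+k,s]p : ∀ k s → p k ^ (s ∸ k) ≤ ∏[ suc k , s ] p
p[k]^length≤∏[1+k,s]p k s = subst (p k ^ (s ∸ k) ≤_) (sym (∏-as-applyUpTo (suc k) s p))
  (^-≤-product-applyUpTo (λ i → p (suc k + i)) (s ∸ k) (λ i → <⇒≤ (p-mono-< (s≤s (m≤m+n k i)))))

4*∏[2,k]p<∏[1+k,s]p : ∀ {k s} → 0 < k → 3 ≤ p k → suc k ≤ s ∸ k → 4 * ∏[ 2 , k ] p < ∏[ suc k , s ] p
4*∏[2,k]p<∏[1+k,s]p {suc k} {s} _ 3≤q k<length = begin-strict
  4 * ∏[ 2 , suc k ] p ≤⟨ *-monoʳ-≤ 4 (∏[2,1+k]p≤p[1+k]^k k) ⟩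
  4 * q ^ k            <⟨ *-monoˡ-< (q ^ k) {{>-nonZero (m^n>0 q k)}} (≤ᵇ⇒≤ 5 9 tt) ⟩
  3 * 3 * q ^ k        ≤⟨ *-monoˡ-≤ (q ^ k) (*-mono-≤ 3≤q 3≤q) ⟩
  q * q * q ^ k        ≡⟨ *-assoc q q (q ^ k) ⟩
  q ^ suc (suc k)      ≤⟨ ^-monoʳ-≤ q k<length ⟩
  q ^ (s ∸ suc k)      ≤⟨ p[k]^length≤∏[1+k,s]p (suc k) s ⟩
  ∏[ suc (suc k) , s ] p ∎
  where
  open ≤-Reasoning
  q : ℕ
  q = p (suc k)
  instance
    q≢0 : NonZero q
    q≢0 = >-nonZero (≤-trans z<s 3≤q)

reaches⇒length>k : ∀ {a k s} → 66 ≤ k → a ≤ 3 → Reaches (suc a) a k s → suc k ≤ s ∸ k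
reaches⇒length>k {a} {k} {s} 66≤k a≤3 reaches = *-cancelˡ-≤ 3 (begin
  3 * suc k   ≤⟨ 3*[1+k]≤p[k] 66≤k ⟩
  p k         ≤⟨ reaches⇒p≤a*length a k s reaches ⟩
  a * (s ∸ k) ≤⟨ *-monoˡ-≤ (s ∸ k) a≤3 ⟩
  3 * (s ∸ k) ∎)
  where open ≤-Reasoning

reaches⇒4*∏[2,k]p<∏[1+k,s]p : ∀ {a k s} → 66 ≤ k → a ≤ 3 → Reaches (suc a) a k s →
  4 * ∏[ 2 , k ] p < ∏[ suc k , s ] p
reaches⇒4*∏[2,k]p<∏[1+k,s]p {k = k} 66≤k a≤3 reaches =
  4*∏[2,k]p<∏[1+k,s]p (≤-trans z<s 66≤k) (≤-trans (m≤m*n 3 (suc k)) (3*[1+k]≤p[k] 66≤k))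
    (reaches⇒length>k 66≤k a≤3 reaches)

lemma4p16 : ∃ λ k′ → ∀ k → k ≥ k′ → ∀ s₁ s₂ → IsU 4 3 k s₁ → IsU 2 1 k s₂ →
  4 * ∏[ 2 , k ] p < (2 * ∏[ suc k , s₁ ] p) ⊓ ∏[ suc k , s₂ ] p
lemma4p16 = 66 , λ k 66≤k s₁ s₂ (reaches₁ , _) (reaches₂ , _) → ⊓-glb
  (<-≤-trans (reaches⇒4*∏[2,k]p<∏[1+k,s]p 66≤k ≤-refl reaches₁) (m≤n*m (∏[ suc k , s₁ ] p) 2))
  (reaches⇒4*∏[2,k]p<∏[1+k,s]p 66≤k (≤ᵇ⇒≤ 1 3 tt) reaches₂)
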